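{- The system $\mathsf{DG}$ proves: for every $Y^2$ which is near-standard, i.e. $(\forall^{\mathrm{st}}f^1)(\exists^{\mathrm{st}}n^0)(Y(f)=n)$, and which satisfies standard extensionality, i.e. $(\forall^{\mathrm{st}}f^1,g^1)\big[(\forall^{\mathrm{st}}n^0)(f(n)=g(n))\rightarrow Y(f)=_0Y(g)\big]$, there is a standard $Z^2$ such that $(\forall f\le_1 1)\big(Z(f)=_0Y(f)\big)$.
   Context: Finite types: $0$ is a type and if $\rho,\sigma$ are types so is $\rho\to\sigma$; type $1=0\to0$, $2=1\to0$. $\mathsf{E\text{ - }HA}^{\omega}$ is Heyting arithmetic in all finite types (intuitionistic logic, Gödel's $T$ constants) with extensionality. Equality $=_0$ is primitive; for $\tau=\tau_1\to\dots\to\tau_k\to0$, $x=_\tau y$ abbreviates $(\forall z_1\dots z_k)(xz_1\dots z_k=_0yz_1\dots z_k)$, and $\le_\tau$ likewise. Extensionality $(\mathsf E_{\rho\to\tau})$: $(\forall\varphi)(\forall x,y)(x=_\rho y\to\varphi(x)=_\tau\varphi(y))$, for all types. Binary sequences: $f\le_1 1$. Strong majorizability (Howard–Bezem): $x\le^*_0 y$ iff $x\le_0 y$; $x\le^*_{\rho\to\sigma}y$ iff for all $u,v$ with $u\le^*_\rho v$: $xu\le^*_\sigma yv$ and $yu\le^*_\sigma yv$. Monotone: $x\le^*x$; $\tilde\forall,\tilde\exists$ range over monotone objects. The language of $\mathsf{DG}$ adds predicates $\mathrm{st}^\sigma$ ("is standard"); $\forall^{\mathrm{st}},\exists^{\mathrm{st}}$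 are the relativised quantifiers, $\tilde\forall^{\mathrm{st}},\tilde\exists^{\mathrm{st}}$ combine both restrictions. Internal = not containing $\mathrm{st}$. $\mathsf{DG}$ is $\mathsf{E\text{ - }HA}^\omega$ in the extended language plus: (a) $x=_\sigma y\to(\mathrm{st}(x)\to\mathrm{st}(y))$; (b) $\mathrm{st}(y)\to(x\le^*_\sigma y\to\mathrm{st}(x))$; (c) $\mathrm{st}(t)$ for closed terms $t$; (d) $\mathrm{st}(z)\to(\mathrm{st}(x)\to\mathrm{st}(zx))$; external induction $\Phi(0)\wedge(\forall^{\mathrm{st}}n)(\Phi(n)\to\Phi(n+1))\to(\forall^{\mathrm{st}}n)\Phi(n)$ for any $\Phi$; and for arbitrary $\Phi,\Psi$ and internal $\phi,\psi$: $\mathsf{mAC}^\omega$: $(\tilde\forall^{\mathrm{st}}x)(\tilde\exists^{\mathrm{st}}y)\Phi(x,y)\to(\tilde\exists^{\mathrm{st}}f)(\tilde\forall^{\mathrm{st}}x)(\exists y\le^*f(x))\Phi(x,y)$; $\mathsf R^\omega$: $(\forall x)(\exists^{\mathrm{st}}y)\Phi(x,y)\to(\tilde\exists^{\mathrm{st}}z)(\forall x)(\exists y\le^*z)\Phi(x,y)$; $\mathsf I^\omega$: $(\tilde\forall^{\mathrm{st}}z)(\exists x)(\forall y\le^*z)\phi(x,y)\to(\exists x)(\forall^{\mathrm{st}}y)\phi(x,y)$; $\mathsf{IP}^\omega_{\tilde\forall^{\mathrm{st}}}$: $[(\tilde\forall^{\mathrm{st}}x)\phi(x)\to(\tilde\exists^{\mathrm{st}}y)\Psi(y)]\to(\tilde\exists^{\mathrm{st}}z)[(\tilde\forall^{\mathrm{st}}x)\phi(x)\to(\tilde\exists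 y\le^*z)\Psi(y)]$; $\mathsf M^\omega$: $[(\tilde\forall^{\mathrm{st}}x)\phi(x)\to\psi]\to(\tilde\exists^{\mathrm{st}}y)[(\forall x\le^*y)\phi(x)\to\psi]$; $\mathsf{MAJ}^\omega$: $(\forall^{\mathrm{st}}x)(\exists^{\mathrm{st}}y)(x\le^*y)$. -}

module Defs where

-- Deep embedding of the formal system DG (E-HA^omega in the language with
-- standardness predicates, plus the nonstandard axioms of DG), and its
-- derivability relation.

open import Data.List using (List; []; _∷_; map)
open import Data.List.Membership.Propositional using (_∈_)

infixr 7 _⇒_
data Ty : Set where
  ι   : Ty                 -- the type 0
  _⇒_ : Ty → Ty → Ty

T1 : Ty
T1 = ι ⇒ ι

T2 : Ty
T2 = T1 ⇒ ι

Ctx : Set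
Ctx = List Ty

data Var : Ctx → Ty → Set where
  vz : ∀ {Γ σ} → Var (σ ∷ Γ) σ
  vs : ∀ {Γ σ τ} → Var Γ σ → Var (τ ∷ Γ) σ

variable
  Γ Δ : Ctx
  σ τ ρ δ : Ty

-- Terms of Goedel's T (combinator presentation, as in Troelstra)

infixl 9 _·_
data Tm (Γ : Ctx) : Ty → Set where
  var : Var Γ σ → Tm Γ σ
  _·_ : Tm Γ (σ ⇒ τ) → Tm Γ σ → Tm Γ τ
  𝟘   : Tm Γ ι
  𝕊   : Tm Γ (ι ⇒ ι)
  Πc  : ∀ ρ σ → Tm Γ (ρ ⇒ σ ⇒ ρ)
  Σc  : ∀ δ ρ σ → Tm Γ ((δ ⇒ ρ ⇒ σ) ⇒ (δ ⇒ ρ) ⇒ δ ⇒ σ)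
  Rc  : ∀ ρ → Tm Γ (ρ ⇒ (ρ ⇒ ι ⇒ ρ) ⇒ ι ⇒ ρ)

infix  6 _≐_
infixr 5 _∧'_ _∨'_
infixr 4 _⊃_
data Fm (Γ : Ctx) : Set where
  _≐_  : Tm Γ ι → Tm Γ ι → Fm Γ
  ⊥'   : Fm Γ
  _∧'_ : Fm Γ → Fm Γ → Fm Γ
  _∨'_ : Fm Γ → Fm Γ → Fm Γ
  _⊃_  : Fm Γ → Fm Γ → Fm Γ
  ∀'   : ∀ σ → Fm (σ ∷ Γ) → Fm Γ
  ∃'   : ∀ σ → Fm (σ ∷ Γ) → Fm Γ
  st   : Tm Γ σ → Fm Γ

data Internal {Γ : Ctx} : Fm Γ → Set where
  i≐ : ∀ {s t} → Internal (s ≐ t)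
  i⊥ : Internal ⊥'
  i∧ : ∀ {A B} → Internal A → Internal B → Internal (A ∧' B)
  i∨ : ∀ {A B} → Internal A → Internal B → Internal (A ∨' B)
  i⊃ : ∀ {A B} → Internal A → Internal B → Internal (A ⊃ B)
  i∀ : ∀ {σ A} → Internal {σ ∷ Γ} A → Internal (∀' σ A)
  i∃ : ∀ {σ A} → Internal {σ ∷ Γ} A → Internal (∃' σ A)

Ren : Ctx → Ctx → Set
Ren Γ Δ = ∀ {σ} → Var Γ σ → Var Δ σ

liftR : Ren Γ Δ → Ren (τ ∷ Γ) (τ ∷ Δ)
liftR r vz     = vz
liftR r (vs x) = vs (r x)

renT : Ren Γ Δ → Tm Γ σ → Tm Δ σ
renT r (var x)      = var (r x)
renT r (s · t)      = renT r s · renT r t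
renT r 𝟘            = 𝟘
renT r 𝕊            = 𝕊
renT r (Πc ρ σ)     = Πc ρ σ
renT r (Σc δ ρ σ)   = Σc δ ρ σ
renT r (Rc ρ)       = Rc ρ

renF : Ren Γ Δ → Fm Γ → Fm Δ
renF r (s ≐ t)  = renT r s ≐ renT r t
renF r ⊥'       = ⊥'
renF r (A ∧' B) = renF r A ∧' renF r B
renF r (A ∨' B) = renF r A ∨' renF r B
renF r (A ⊃ B)  = renF r A ⊃ renF r B
renF r (∀' σ A) = ∀' σ (renF (liftR r) A)
renF r (∃' σ A) = ∃' σ (renF (liftR r) A)
renF r (st t)   = st (renT r t)

wkT : Tm Γ σ → Tm (τ ∷ Γ) σ
wkT = renT vs

wkF : Fm Γ → Fm (τ ∷ Γ)
wkF = renF vs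

closedT : Tm [] σ → Tm Γ σ
closedT = renT (λ ())

Sub : Ctx → Ctx → Set
Sub Γ Δ = ∀ {σ} → Var Γ σ → Tm Δ σ

liftS : Sub Γ Δ → Sub (τ ∷ Γ) (τ ∷ Δ)
liftS s vz     = var vz
liftS s (vs x) = wkT (s x)

subT : Sub Γ Δ → Tm Γ σ → Tm Δ σ
subT r (var x)      = r x
subT r (s · t)      = subT r s · subT r t
subT r 𝟘            = 𝟘
subT r 𝕊            = 𝕊
subT r (Πc ρ σ)     = Πc ρ σ
subT r (Σc δ ρ σ)   = Σc δ ρ σ
subT r (Rc ρ)       = Rc ρ

subF : Sub Γ Δ → Fm Γ → Fm Δ
subF r (s ≐ t)  = subT r s ≐ subT r t
subF r ⊥'       = ⊥'
subF r (A ∧' B) = subF r A ∧' subF r B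
subF r (A ∨' B) = subF r A ∨' subF r B
subF r (A ⊃ B)  = subF r A ⊃ subF r B
subF r (∀' σ A) = ∀' σ (subF (liftS r) A)
subF r (∃' σ A) = ∃' σ (subF (liftS r) A)
subF r (st t)   = st (subT r t)

sub0 : Tm Γ σ → Sub (σ ∷ Γ) Γ
sub0 t vz     = t
sub0 t (vs x) = var x

infixl 8 _[_]
_[_] : Fm (σ ∷ Γ) → Tm Γ σ → Fm Γ
A [ t ] = subF (sub0 t) A

succSub : Sub (ι ∷ Γ) (ι ∷ Γ)
succSub vz     = 𝕊 · var vz
succSub (vs x) = var (vs x)

stepF : Fm (ι ∷ Γ) → Fm (ι ∷ Γ)
stepF = subF succSub

-- Φ(x,y) (x = var 1, y = var 0) moved under one extra outer binder
under2 : Fm (σ ∷ ρ ∷ Γ) → Fm (σ ∷ ρ ∷ τ ∷ Γ)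
under2 = renF (liftR (liftR vs))

under1 : Fm (σ ∷ Γ) → Fm (σ ∷ τ ∷ Γ)
under1 = renF (liftR vs)

v0 : Tm (σ ∷ Γ) σ
v0 = var vz

v1 : Tm (τ ∷ σ ∷ Γ) σ
v1 = var (vs vz)

v2 : Tm (τ ∷ ρ ∷ σ ∷ Γ) σ
v2 = var (vs (vs vz))

eqT : ∀ σ → Tm Γ σ → Tm Γ σ → Fm Γ
eqT ι       s t = s ≐ t
eqT (ρ ⇒ σ) s t = ∀' ρ (eqT σ (wkT s · v0) (wkT t · v0))

-- addition as a term of T:  x + y = R x (λ a n. S a) y
sucStep : Tm Γ (ι ⇒ ι ⇒ ι)
sucStep = Σc ι ι (ι ⇒ ι) · (Πc (ι ⇒ ι ⇒ ι) ι · Πc ι ι) · 𝕊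

addT : Tm Γ ι → Tm Γ ι → Tm Γ ι
addT x y = Rc ι · x · sucStep · y

le0 : Tm Γ ι → Tm Γ ι → Fm Γ
le0 x y = ∃' ι (addT (wkT x) v0 ≐ wkT y)

leT : ∀ σ → Tm Γ σ → Tm Γ σ → Fm Γ
leT ι       s t = le0 s t
leT (ρ ⇒ σ) s t = ∀' ρ (leT σ (wkT s · v0) (wkT t · v0))

oneFn : Tm Γ T1
oneFn = Πc ι ι · (𝕊 · 𝟘)

wk2T : Tm Γ σ → Tm (ρ ∷ τ ∷ Γ) σ
wk2T = renT (λ x → vs (vs x))

-- strong majorizability x ≤*_σ y (Howard–Bezem)
maj : ∀ σ → Tm Γ σ → Tm Γ σ → Fm Γ
maj ι       x y = le0 x y
maj (ρ ⇒ σ) x y =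
  ∀' ρ (∀' ρ (maj ρ v1 v0 ⊃
     (maj σ (wk2T x · v1) (wk2T y · v0) ∧' maj σ (wk2T y · v1) (wk2T y · v0))))

∀st ∃st ∀̃st ∃̃st ∃̃ : ∀ σ → Fm (σ ∷ Γ) → Fm Γ
∀st σ A = ∀' σ (st v0 ⊃ A)
∃st σ A = ∃' σ (st v0 ∧' A)
∀̃st σ A = ∀' σ (st v0 ⊃ (maj σ v0 v0 ⊃ A))
∃̃st σ A = ∃' σ (st v0 ∧' (maj σ v0 v0 ∧' A))
∃̃  σ A = ∃' σ (maj σ v0 v0 ∧' A)

∀≤* ∃≤* : ∀ σ → Tm Γ σ → Fm (σ ∷ Γ) → Fm Γ
∀≤* σ b A = ∀' σ (maj σ v0 (wkT b) ⊃ A)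
∃≤* σ b A = ∃' σ (maj σ v0 (wkT b) ∧' A)

-- Axioms of DG (schemata with parameters = free variables of Γ)

data Ax {Γ : Ctx} : Fm Γ → Set where
  eqRefl  : (t : Tm Γ ι) → Ax (t ≐ t)
  eqRepl  : (A : Fm (ι ∷ Γ)) (s t : Tm Γ ι) → Ax (s ≐ t ⊃ (A [ s ] ⊃ A [ t ]))
  sucNZ   : (t : Tm Γ ι) → Ax (𝕊 · t ≐ 𝟘 ⊃ ⊥')
  sucInj  : (s t : Tm Γ ι) → Ax (𝕊 · s ≐ 𝕊 · t ⊃ s ≐ t)
  Πax     : (x : Tm Γ ρ) (y : Tm Γ σ) → Ax (eqT ρ (Πc ρ σ · x · y) x)
  Σax     : (x : Tm Γ (δ ⇒ ρ ⇒ σ)) (y : Tm Γ (δ ⇒ ρ)) (z : Tm Γ δ) →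
            Ax (eqT σ (Σc δ ρ σ · x · y · z) (x · z · (y · z)))
  R0ax    : (y : Tm Γ ρ) (x : Tm Γ (ρ ⇒ ι ⇒ ρ)) →
            Ax (eqT ρ (Rc ρ · y · x · 𝟘) y)
  RSax    : (y : Tm Γ ρ) (x : Tm Γ (ρ ⇒ ι ⇒ ρ)) (n : Tm Γ ι) →
            Ax (eqT ρ (Rc ρ · y · x · (𝕊 · n)) (x · (Rc ρ · y · x · n) · n))
  ind     : (A : Fm (ι ∷ Γ)) → Internal A →
            Ax (A [ 𝟘 ] ⊃ (∀' ι (A ⊃ stepF A) ⊃ ∀' ι A))
  ext     : (φ : Tm Γ (ρ ⇒ τ)) (x y : Tm Γ ρ) →
            Ax (eqT ρ x y ⊃ eqT τ (φ · x) (φ · y))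
  stEq    : (x y : Tm Γ σ) → Ax (eqT σ x y ⊃ (st x ⊃ st y))
  stMaj   : (x y : Tm Γ σ) → Ax (st y ⊃ (maj σ x y ⊃ st x))
  stClos  : (t : Tm [] σ) → Ax (st (closedT {Γ = Γ} t))
  stApp   : (z : Tm Γ (σ ⇒ τ)) (x : Tm Γ σ) → Ax (st z ⊃ (st x ⊃ st (z · x)))
  extInd  : (A : Fm (ι ∷ Γ)) →
            Ax ((A [ 𝟘 ] ∧' ∀st ι (A ⊃ stepF A)) ⊃ ∀st ι A)
  -- mAC^ω ; Φ(x,y): x = var 1 : ρ, y = var 0 : σ
  mAC     : (Φ : Fm (σ ∷ ρ ∷ Γ)) →
            Ax (∀̃st ρ (∃̃st σ Φ) ⊃
                ∃̃st (ρ ⇒ σ) (∀̃st ρ (∃≤* σ (v1 · v0) (under2 Φ))))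
  Rω      : (Φ : Fm (σ ∷ ρ ∷ Γ)) →
            Ax (∀' ρ (∃st σ Φ) ⊃ ∃̃st σ (∀' ρ (∃≤* σ v1 (under2 Φ))))
  -- I^ω ; φ(x,y): x = var 1 : ρ, y = var 0 : σ
  Iω      : (φ : Fm (σ ∷ ρ ∷ Γ)) → Internal φ →
            Ax (∀̃st σ (∃' ρ (∀≤* σ v1 (under2 φ))) ⊃ ∃' ρ (∀st σ φ))
  IPω     : (φ : Fm (ρ ∷ Γ)) → Internal φ → (Ψ : Fm (σ ∷ Γ)) →
            Ax ((∀̃st ρ φ ⊃ ∃̃st σ Ψ) ⊃
                ∃̃st σ (∀̃st ρ (under1 φ) ⊃
                        ∃' σ (maj σ v0 v0 ∧' (maj σ v0 v1 ∧' under1 Ψ))))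
  Mω      : (φ : Fm (ρ ∷ Γ)) → Internal φ → (ψ : Fm Γ) → Internal ψ →
            Ax ((∀̃st ρ φ ⊃ ψ) ⊃ ∃̃st ρ (∀≤* ρ v0 (under1 φ) ⊃ wkF ψ))
  MAJ     : (x : Tm Γ σ) → Ax (st x ⊃ ∃st σ (maj σ (wkT x) v0))

infix 3 _∣_⊢_
data _∣_⊢_ : (Γ : Ctx) → List (Fm Γ) → Fm Γ → Set where
  hyp  : ∀ {Hs A} → A ∈ Hs → Γ ∣ Hs ⊢ A
  ax   : ∀ {Hs A} → Ax A → Γ ∣ Hs ⊢ A
  ⊥E   : ∀ {Hs A} → Γ ∣ Hs ⊢ ⊥' → Γ ∣ Hs ⊢ A
  ∧I   : ∀ {Hs A B} → Γ ∣ Hs ⊢ A → Γ ∣ Hs ⊢ B → Γ ∣ Hs ⊢ A ∧' B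
  ∧E₁  : ∀ {Hs A B} → Γ ∣ Hs ⊢ A ∧' B → Γ ∣ Hs ⊢ A
  ∧E₂  : ∀ {Hs A B} → Γ ∣ Hs ⊢ A ∧' B → Γ ∣ Hs ⊢ B
  ∨I₁  : ∀ {Hs A B} → Γ ∣ Hs ⊢ A → Γ ∣ Hs ⊢ A ∨' B
  ∨I₂  : ∀ {Hs A B} → Γ ∣ Hs ⊢ B → Γ ∣ Hs ⊢ A ∨' B
  ∨E   : ∀ {Hs A B C} → Γ ∣ Hs ⊢ A ∨' B →
         Γ ∣ A ∷ Hs ⊢ C → Γ ∣ B ∷ Hs ⊢ C → Γ ∣ Hs ⊢ C
  ⊃I   : ∀ {Hs A B} → Γ ∣ A ∷ Hs ⊢ B → Γ ∣ Hs ⊢ A ⊃ B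
  ⊃E   : ∀ {Hs A B} → Γ ∣ Hs ⊢ A ⊃ B → Γ ∣ Hs ⊢ A → Γ ∣ Hs ⊢ B
  ∀I   : ∀ {Hs A} → (σ ∷ Γ) ∣ map wkF Hs ⊢ A → Γ ∣ Hs ⊢ ∀' σ A
  ∀E   : ∀ {Hs A} → Γ ∣ Hs ⊢ ∀' σ A → (t : Tm Γ σ) → Γ ∣ Hs ⊢ A [ t ]
  ∃I   : ∀ {Hs A} → (t : Tm Γ σ) → Γ ∣ Hs ⊢ A [ t ] → Γ ∣ Hs ⊢ ∃' σ A
  ∃E   : ∀ {Hs A C} → Γ ∣ Hs ⊢ ∃' σ A →
         (σ ∷ Γ) ∣ A ∷ map wkF Hs ⊢ wkF C → Γ ∣ Hs ⊢ C

DG⊢ : Fm [] → Set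
DG⊢ A = [] ∣ [] ⊢ A

module Submission where

-- Let Tr f := sg ∘ f be the truncation of f to a binary sequence. Every Tr f is
-- majorised by the constant-one function, hence standard, so near-standardness
-- gives a standard value Y (Tr f) for every f. R^ω turns this into one standard
-- bound z with Y (Tr f) ≤ z for all f; then Y ∘ Tr is majorised by the standard
-- λf. z and is therefore standard. On binary f we have Tr f = f, so by
-- extensionality Y ∘ Tr agrees with Y there.

open import Defs
open import Data.List using (List; _∷_; map)
open import Data.List.Relation.Unary.Any using (here; there)
open import Relation.Binary.PropositionalEquality
  using (_≡_; refl; sym; trans; cong; cong₂)

subT-sub0-wkT : (u : Tm Γ σ) (t : Tm Γ τ) → subT (sub0 u) (wkT t) ≡ t
subT-sub0-wkT u (var x)    = refl
subT-sub0-wkT u (s · t)    = cong₂ _·_ (subT-sub0-wkT u s) (subT-sub0-wkT u t)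
subT-sub0-wkT u 𝟘          = refl
subT-sub0-wkT u 𝕊          = refl
subT-sub0-wkT u (Πc _ _)   = refl
subT-sub0-wkT u (Σc _ _ _) = refl
subT-sub0-wkT u (Rc _)     = refl

subT-liftS-wkT : (s : Sub Γ Δ) (t : Tm Γ τ) →
                 subT (liftS {τ = σ} s) (wkT t) ≡ wkT (subT s t)
subT-liftS-wkT s (var x)    = refl
subT-liftS-wkT s (f · t)    = cong₂ _·_ (subT-liftS-wkT s f) (subT-liftS-wkT s t)
subT-liftS-wkT s 𝟘          = refl
subT-liftS-wkT s 𝕊          = refl
subT-liftS-wkT s (Πc _ _)   = refl
subT-liftS-wkT s (Σc _ _ _) = refl
subT-liftS-wkT s (Rc _)     = refl

subF-eqT : (s : Sub Γ Δ) (τ : Ty) (x y : Tm Γ τ) →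
           subF s (eqT τ x y) ≡ eqT τ (subT s x) (subT s y)
subF-eqT s ι       x y = refl
subF-eqT s (ρ ⇒ τ) x y = cong (∀' ρ) (trans
  (subF-eqT (liftS s) τ (wkT x · v0) (wkT y · v0))
  (cong₂ (λ p q → eqT τ (p · v0) (q · v0)) (subT-liftS-wkT s x) (subT-liftS-wkT s y)))

subF-le0 : (s : Sub Γ Δ) (x y : Tm Γ ι) → subF s (le0 x y) ≡ le0 (subT s x) (subT s y)
subF-le0 s x y = cong₂ (λ p q → ∃' ι (addT p v0 ≐ q))
  (subT-liftS-wkT s x) (subT-liftS-wkT s y)

const : Tm Γ σ → Tm Γ (τ ⇒ σ)
const {σ = σ} {τ = τ} x = Πc σ τ · x

compose : Tm Γ (ρ ⇒ ι) → Tm Γ (δ ⇒ ρ) → Tm Γ (δ ⇒ ι)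
compose {ρ = ρ} {δ = δ} g f = Σc δ ρ ι · const g · f

one : Tm Γ ι
one = 𝕊 · 𝟘

private variable
  Hs : List (Fm _)

cast : {A B : Fm Γ} → A ≡ B → Γ ∣ Hs ⊢ A → Γ ∣ Hs ⊢ B
cast refl d = d

≐-replace : (A : Fm (ι ∷ Γ)) {s t : Tm Γ ι} →
            Γ ∣ Hs ⊢ s ≐ t → Γ ∣ Hs ⊢ A [ s ] → Γ ∣ Hs ⊢ A [ t ]
≐-replace A {s} {t} s≐t = ⊃E (⊃E (ax (eqRepl A s t)) s≐t)

≐-sym : {s t : Tm Γ ι} → Γ ∣ Hs ⊢ s ≐ t → Γ ∣ Hs ⊢ t ≐ s
≐-sym {s = s} {t = t} s≐t = cast (cong (t ≐_) (subT-sub0-wkT t s))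
  (≐-replace (v0 ≐ wkT s) s≐t
    (cast (cong (s ≐_) (sym (subT-sub0-wkT s s))) (ax (eqRefl s))))

≐-trans : {s t u : Tm Γ ι} → Γ ∣ Hs ⊢ s ≐ t → Γ ∣ Hs ⊢ t ≐ u → Γ ∣ Hs ⊢ s ≐ u
≐-trans {s = s} {t = t} {u = u} s≐t t≐u = cast (cong (_≐ u) (subT-sub0-wkT u s))
  (≐-replace (wkT s ≐ v0) t≐u (cast (cong (_≐ t) (sym (subT-sub0-wkT t s))) s≐t))

≐-cong : (F : Tm Γ (ι ⇒ τ)) {s t : Tm Γ ι} →
         Γ ∣ Hs ⊢ s ≐ t → Γ ∣ Hs ⊢ eqT τ (F · s) (F · t)
≐-cong F {s} {t} = ⊃E (ax (ext F s t))

eqT-app : {f g : Tm Γ (ρ ⇒ τ)} →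
          Γ ∣ Hs ⊢ eqT (ρ ⇒ τ) f g → (u : Tm Γ ρ) → Γ ∣ Hs ⊢ eqT τ (f · u) (g · u)
eqT-app {τ = τ} {f = f} {g = g} f≐g u = cast
  (trans (subF-eqT (sub0 u) τ (wkT f · v0) (wkT g · v0))
         (cong₂ (λ p q → eqT τ (p · u) (q · u)) (subT-sub0-wkT u f) (subT-sub0-wkT u g)))
  (∀E f≐g u)

le0-intro : {x y : Tm Γ ι} (k : Tm Γ ι) → Γ ∣ Hs ⊢ addT x k ≐ y → Γ ∣ Hs ⊢ le0 x y
le0-intro {x = x} {y = y} k x+k≐y = ∃I k
  (cast (cong₂ (λ p q → addT p k ≐ q) (sym (subT-sub0-wkT k x)) (sym (subT-sub0-wkT k y)))
        x+k≐y)

le0-respˡ : {x x′ y : Tm Γ ι} → Γ ∣ Hs ⊢ x ≐ x′ → Γ ∣ Hs ⊢ le0 x y → Γ ∣ Hs ⊢ le0 x′ y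
le0-respˡ {x = x} {x′ = x′} {y = y} x≐x′ x≤y = cast (le0-at x′)
  (≐-replace (le0 v0 (wkT y)) x≐x′ (cast (sym (le0-at x)) x≤y))
  where
  le0-at : (u : Tm _ ι) → le0 v0 (wkT y) [ u ] ≡ le0 u y
  le0-at u = trans (subF-le0 (sub0 u) v0 (wkT y)) (cong (le0 u) (subT-sub0-wkT u y))

le0-respʳ : {x y y′ : Tm Γ ι} → Γ ∣ Hs ⊢ y ≐ y′ → Γ ∣ Hs ⊢ le0 x y → Γ ∣ Hs ⊢ le0 x y′
le0-respʳ {x = x} {y = y} {y′ = y′} y≐y′ x≤y = cast (le0-at y′)
  (≐-replace (le0 (wkT x) v0) y≐y′ (cast (sym (le0-at y)) x≤y))
  where
  le0-at : (u : Tm _ ι) → le0 (wkT x) v0 [ u ] ≡ le0 x u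
  le0-at u = trans (subF-le0 (sub0 u) (wkT x) v0) (cong (λ p → le0 p u) (subT-sub0-wkT u x))

induction : (A : Fm (ι ∷ Γ)) → Internal A →
            Γ ∣ Hs ⊢ A [ 𝟘 ] → (ι ∷ Γ) ∣ A ∷ map wkF Hs ⊢ stepF A → Γ ∣ Hs ⊢ ∀' ι A
induction A internal base step = ⊃E (⊃E (ax (ind A internal)) base) (∀I (⊃I step))

const-app : (x : Tm Γ σ) (y : Tm Γ τ) → Γ ∣ Hs ⊢ eqT σ (const x · y) x
const-app x y = ax (Πax x y)

le0-const : (z : Tm Γ ι) (x y : Tm Γ τ) → Γ ∣ Hs ⊢ le0 (const z · x) (const z · y)
le0-const z x y = le0-respʳ (≐-sym (const-app z y))
  (le0-respˡ (≐-sym (const-app z x)) (le0-intro 𝟘 (ax (R0ax z sucStep))))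

compose-app : (g : Tm Γ (ρ ⇒ ι)) (f : Tm Γ (δ ⇒ ρ)) (x : Tm Γ δ) →
              Γ ∣ Hs ⊢ compose g f · x ≐ g · (f · x)
compose-app g f x = ≐-trans (ax (Σax (const g) f x)) (eqT-app (const-app g x) (f · x))

addT-zeroʳ : (x : Tm Γ ι) → Γ ∣ Hs ⊢ addT x 𝟘 ≐ x
addT-zeroʳ x = ax (R0ax x sucStep)

sucStep-app : (a m : Tm Γ ι) → Γ ∣ Hs ⊢ sucStep · a · m ≐ 𝕊 · a
sucStep-app a m = ≐-trans (eqT-app (ax (Σax (const (Πc ι ι)) 𝕊 a)) m)
  (≐-trans (eqT-app (eqT-app (const-app (Πc ι ι) a) (𝕊 · a)) m) (const-app (𝕊 · a) m))

addT-sucʳ : (x n : Tm Γ ι) → Γ ∣ Hs ⊢ addT x (𝕊 · n) ≐ 𝕊 · addT x n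
addT-sucʳ x n = ≐-trans (ax (RSax x sucStep n)) (sucStep-app (addT x n) n)

sg : Tm Γ (ι ⇒ ι)
sg = Rc ι · 𝟘 · const (const one)

truncate : Tm Γ (T1 ⇒ T1)
truncate = Σc ι ι ι · const sg

sg-zero : Γ ∣ Hs ⊢ sg · 𝟘 ≐ 𝟘
sg-zero = ax (R0ax 𝟘 (const (const one)))

sg-suc : (n : Tm Γ ι) → Γ ∣ Hs ⊢ sg · (𝕊 · n) ≐ one
sg-suc n = ≐-trans (ax (RSax 𝟘 (const (const one)) n))
  (≐-trans (eqT-app (const-app (const one) (sg · n)) n) (const-app one n))

sg≤one : (n : Tm Γ ι) → Γ ∣ Hs ⊢ le0 (sg · n) one
sg≤one = ∀E (induction (le0 (sg · v0) one) (i∃ i≐)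
  (le0-intro one (≐-trans (addT-sucʳ _ 𝟘) (≐-cong 𝕊 (≐-trans (addT-zeroʳ _) sg-zero))))
  (le0-intro 𝟘 (≐-trans (addT-zeroʳ _) (sg-suc v0))))

x+k≐0⇒x≐0 : (x k : Tm Γ ι) → Γ ∣ Hs ⊢ addT x k ≐ 𝟘 → Γ ∣ Hs ⊢ x ≐ 𝟘
x+k≐0⇒x≐0 x k = ⊃E (cast (cong (λ w → addT x w ≐ 𝟘 ⊃ x ≐ 𝟘) (subT-sub0-wkT x k))
                          (∀E (∀E by-induction k) x))
  where
  by-induction : Γ ∣ Hs ⊢ ∀' ι (∀' ι (addT v0 v1 ≐ 𝟘 ⊃ v0 ≐ 𝟘))
  by-induction = induction _ (i∀ (i⊃ i≐ i≐))
    (∀I (⊃I (≐-trans (≐-sym (addT-zeroʳ v0)) (hyp (here refl)))))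
    (∀I (⊃I (⊥E (⊃E (ax (sucNZ _)) (≐-trans (≐-sym (addT-sucʳ v0 v1)) (hyp (here refl)))))))

sg-fixes-le-one : (x : Tm Γ ι) → Γ ∣ Hs ⊢ le0 x one → Γ ∣ Hs ⊢ sg · x ≐ x
sg-fixes-le-one x x≤1 = ∃E x≤1 (⊃E (∀E (∀E by-induction v0) (wkT x)) (hyp (here refl)))
  where
  by-induction : Γ ∣ Hs ⊢ ∀' ι (∀' ι (addT v0 v1 ≐ one ⊃ sg · v0 ≐ v0))
  by-induction = induction _ (i∀ (i⊃ i≐ i≐))
    (∀I (⊃I (≐-trans (≐-cong sg x≐1) (≐-trans (sg-suc 𝟘) (≐-sym x≐1)))))
    (∀I (⊃I (≐-trans (≐-cong sg x≐0) (≐-trans sg-zero (≐-sym x≐0)))))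
    where
    x≐1 : ι ∷ _ ∣ addT v0 𝟘 ≐ one ∷ _ ⊢ v0 ≐ one
    x≐1 = ≐-trans (≐-sym (addT-zeroʳ v0)) (hyp (here refl))
    x≐0 : ι ∷ ι ∷ _ ∣ addT v0 (𝕊 · v1) ≐ one ∷ _ ⊢ v0 ≐ 𝟘
    x≐0 = x+k≐0⇒x≐0 v0 v1
      (⊃E (ax (sucInj _ _)) (≐-trans (≐-sym (addT-sucʳ v0 v1)) (hyp (here refl))))

truncate-app : (f : Tm Γ T1) (n : Tm Γ ι) → Γ ∣ Hs ⊢ truncate · f · n ≐ sg · (f · n)
truncate-app = compose-app sg

maj-const : {x : Tm Γ (σ ⇒ ι)} {z : Tm Γ ι} →
            σ ∷ σ ∷ Γ ∣ maj σ v1 v0 ∷ map wkF (map wkF Hs) ⊢ le0 (wk2T x · v1) (wk2T z) →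
            Γ ∣ Hs ⊢ maj (σ ⇒ ι) x (const z)
maj-const {z = z} x≤z = ∀I (∀I (⊃I (∧I
  (le0-respʳ (≐-sym (const-app (wk2T z) v0)) x≤z)
  (le0-const (wk2T z) v1 v0))))

st-truncate : (f : Tm Γ T1) → Γ ∣ Hs ⊢ st (truncate · f)
st-truncate f = ⊃E (⊃E (ax (stMaj (truncate · f) oneFn)) (ax (stClos oneFn)))
  (maj-const (le0-respˡ (≐-sym (truncate-app (wk2T f) v1)) (sg≤one _)))

truncate-fixes-binary : T1 ∷ Γ ∣ Hs ⊢ leT T1 v0 oneFn ⊃ eqT T1 (truncate · v0) v0
truncate-fixes-binary = ⊃I (∀I (≐-trans (truncate-app v1 v0)
  (sg-fixes-le-one _ (le0-respʳ (const-app one v0) (∀E (hyp (here refl)) v0)))))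

compose-truncate-agrees-on-binary :
  (Y : Tm Γ T2) → Γ ∣ Hs ⊢ ∀' T1 (leT T1 v0 oneFn ⊃ compose (wkT Y) truncate · v0 ≐ wkT Y · v0)
compose-truncate-agrees-on-binary Y = ∀I (⊃I (≐-trans (compose-app (wkT Y) truncate v0)
  (⊃E (ax (ext (wkT Y) (truncate · v0) v0)) (⊃E truncate-fixes-binary (hyp (here refl))))))

-- In context n ∷ f ∷ Y ∷ Γ: Y (Tr f) = n.
TruncationValue : Fm (ι ∷ T1 ∷ T2 ∷ Γ)
TruncationValue = v2 · (truncate · v1) ≐ v0

-- In context z ∷ Y ∷ Γ: (∀f)(∃n ≤* z) Y (Tr f) = n.
BoundsTruncations : Fm (ι ∷ T2 ∷ Γ)
BoundsTruncations = ∀' T1 (∃≤* ι v1 (under2 TruncationValue))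

near-standard⇒truncations-bounded :
  T2 ∷ Γ ∣ Hs ⊢ ∀st T1 (∃st ι (v2 · v1 ≐ v0)) ⊃ ∃̃st ι BoundsTruncations
near-standard⇒truncations-bounded = ⊃I (⊃E (ax (Rω TruncationValue))
  (∀I (⊃E (∀E (hyp (here refl)) (truncate · v0)) (st-truncate v0))))

truncations-bounded⇒st-compose :
  ι ∷ T2 ∷ Γ ∣ Hs ⊢ st v0 ∧' (maj ι v0 v0 ∧' BoundsTruncations) ⊃ st (compose v1 truncate)
truncations-bounded⇒st-compose =
  ⊃I (⊃E (⊃E (ax (stMaj (compose v1 truncate) (const v0))) st-const) (maj-const bounded))
  where
  st-const : ι ∷ T2 ∷ _ ∣ (st v0 ∧' _) ∷ _ ⊢ st (const {τ = T1} v0)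
  st-const = ⊃E (⊃E (ax (stApp (Πc ι T1) v0)) (ax (stClos (Πc ι T1)))) (∧E₁ (hyp (here refl)))
  bounded : T1 ∷ T1 ∷ ι ∷ T2 ∷ _ ∣ maj T1 v1 v0 ∷ _ ⊢
            le0 (compose (var (vs (vs (vs vz)))) truncate · v1) v2
  bounded = ∃E (∀E (∧E₂ (∧E₂ (hyp (there (here refl))))) v1)
    (le0-respˡ (≐-sym (≐-trans (compose-app _ truncate v2) (∧E₂ (hyp (here refl)))))
               (∧E₁ (hyp (here refl))))

corollary3p15 : DG⊢ (∀' T2 ((∀st T1 (∃st ι (v2 · v1 ≐ v0)) ∧' ∀st T1 (∀st T1 (∀st ι (v2 · v0 ≐ v1 · v0) ⊃ v2 · v1 ≐ v2 · v0))) ⊃ ∃st T2 (∀' T1 (leT T1 v0 oneFn ⊃ v1 · v0 ≐ v2 · v0))))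
corollary3p15 = ∀I (⊃I (∃E (⊃E near-standard⇒truncations-bounded (∧E₁ (hyp (here refl))))
  (∃I (compose v1 truncate)
      (∧I (⊃E truncations-bounded⇒st-compose (hyp (here refl)))
          (compose-truncate-agrees-on-binary v1)))))
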